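{- Let $k$ be a non-negative integer. Every graph in $\Delta_k$ is a block graph with no simplicial vertex of degree at least $2$.
   Context: Graphs are finite and simple. A graph is a block graph if every block (maximal connected subgraph without cut-vertices) is a complete graph. A vertex is simplicial if its neighbors form a clique. A delta composition of $G_1,G_2,G_3$ is obtained from their disjoint union by choosing $v_i\in V(G_i)$ and adding the triangle $v_1v_2v_3$. $\Delta_0=\{K_2\}$, and for $i\ge1$, $\Delta_i$ is the set of delta compositions of three (not necessarily distinct) graphs in $\Delta_{i-1}$, up to isomorphism. -}

module Defs where

open import Data.Nat using (ℕ; _+_)
open import Data.Fin using (Fin; _≟_; splitAt; _↑ˡ_; _↑ʳ_)
open import Data.Fin.Properties using () renaming (_≟_ to _≟F_)
open import Data.Bool using (Bool; true; false; _∧_; _∨_; not)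
open import Data.Bool.Properties using (∧-comm; ∨-identityʳ)
open import Data.Sum using (_⊎_; inj₁; inj₂)
open import Data.Product using (Σ; _×_; _,_; ∃)
open import Data.List using (List; length; filterᵇ; allFin)
open import Relation.Nullary using (¬_; yes; no)
open import Relation.Nullary.Decidable using (⌊_⌋)
open import Relation.Binary.PropositionalEquality using (_≡_; refl; _≢_; cong; cong₂; sym)

record Graph : Set where
  field
    n      : ℕ
    adj    : Fin n → Fin n → Bool
    adj-sym    : ∀ i j → adj i j ≡ adj j i
    adj-irrefl : ∀ i → adj i i ≡ false
open Graph public

eqᵇ : ∀ {n} → Fin n → Fin n → Bool
eqᵇ i j = ⌊ i ≟ j ⌋

eqᵇ-sym : ∀ {n} (i j : Fin n) → eqᵇ i j ≡ eqᵇ j i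
eqᵇ-sym i j with i ≟ j | j ≟ i
... | yes _ | yes _ = refl
... | no _  | no _  = refl
... | yes p | no q  = Data.Empty.⊥-elim (q (sym p)) where import Data.Empty
... | no p  | yes q = Data.Empty.⊥-elim (p (sym q)) where import Data.Empty

eqᵇ-refl : ∀ {n} (i : Fin n) → eqᵇ i i ≡ true
eqᵇ-refl i with i ≟ i
... | yes _ = refl
... | no p = Data.Empty.⊥-elim (p refl) where import Data.Empty

K₂ : Graph
K₂ = record { n = 2 ; adj = λ i j → not (eqᵇ i j)
            ; adj-sym = λ i j → cong not (eqᵇ-sym i j)
            ; adj-irrefl = λ i → cong not (eqᵇ-refl i) }

uadj : ∀ {n m} → (Fin n → Fin n → Bool) → (Fin m → Fin m → Bool)
     → Fin n ⊎ Fin m → Fin n ⊎ Fin m → Bool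
uadj a b (inj₁ i) (inj₁ j) = a i j
uadj a b (inj₂ i) (inj₂ j) = b i j
uadj a b _ _ = false

uadj-sym : ∀ {n m} (a : Fin n → Fin n → Bool) (b : Fin m → Fin m → Bool)
  → (∀ i j → a i j ≡ a j i) → (∀ i j → b i j ≡ b j i)
  → ∀ x y → uadj a b x y ≡ uadj a b y x
uadj-sym a b sa sb (inj₁ i) (inj₁ j) = sa i j
uadj-sym a b sa sb (inj₁ i) (inj₂ j) = refl
uadj-sym a b sa sb (inj₂ i) (inj₁ j) = refl
uadj-sym a b sa sb (inj₂ i) (inj₂ j) = sb i j

uadj-irr : ∀ {n m} (a : Fin n → Fin n → Bool) (b : Fin m → Fin m → Bool)
  → (∀ i → a i i ≡ false) → (∀ i → b i i ≡ false)
  → ∀ x → uadj a b x x ≡ false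
uadj-irr a b ia ib (inj₁ i) = ia i
uadj-irr a b ia ib (inj₂ i) = ib i

_⊕_ : Graph → Graph → Graph
G ⊕ H = record
  { n = n G + n H
  ; adj = λ i j → uadj (adj G) (adj H) (splitAt (n G) i) (splitAt (n G) j)
  ; adj-sym = λ i j → uadj-sym (adj G) (adj H) (adj-sym G) (adj-sym H)
                        (splitAt (n G) i) (splitAt (n G) j)
  ; adj-irrefl = λ i → uadj-irr (adj G) (adj H) (adj-irrefl G) (adj-irrefl H)
                        (splitAt (n G) i) }

addTriangle : (G : Graph) → Fin (n G) → Fin (n G) → Fin (n G) → Graph
addTriangle G x y z = record
  { n = n G
  ; adj = λ i j → adj G i j ∨ (T i ∧ T j ∧ not (eqᵇ i j))
  ; adj-sym = λ i j → cong₂ _∨_ (adj-sym G i j) (lem i j)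
  ; adj-irrefl = λ i → irr i }
  where
  T : Fin (n G) → Bool
  T i = eqᵇ i x ∨ eqᵇ i y ∨ eqᵇ i z
  lem : ∀ i j → T i ∧ T j ∧ not (eqᵇ i j) ≡ T j ∧ T i ∧ not (eqᵇ j i)
  lem i j with T i | T j
  ... | false | false = refl
  ... | false | true = refl
  ... | true | false = refl
  ... | true | true = cong not (eqᵇ-sym i j)
  irr : ∀ i → adj G i i ∨ (T i ∧ T i ∧ not (eqᵇ i i)) ≡ false
  irr i rewrite adj-irrefl G i | eqᵇ-refl i with T i
  ... | false = refl
  ... | true = refl

delta : (G₁ G₂ G₃ : Graph) → Fin (n G₁) → Fin (n G₂) → Fin (n G₃) → Graph
delta G₁ G₂ G₃ v₁ v₂ v₃ =
  addTriangle (G₁ ⊕ (G₂ ⊕ G₃))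
    (v₁ ↑ˡ (n G₂ + n G₃))
    (n G₁ ↑ʳ (v₂ ↑ˡ n G₃))
    (n G₁ ↑ʳ (n G₂ ↑ʳ v₃))

record _≅_ (G H : Graph) : Set where
  field
    to   : Fin (n G) → Fin (n H)
    from : Fin (n H) → Fin (n G)
    from∘to : ∀ i → from (to i) ≡ i
    to∘from : ∀ j → to (from j) ≡ j
    preserves : ∀ i j → adj G i j ≡ adj H (to i) (to j)

data InΔ : ℕ → Graph → Set where
  base : InΔ 0 K₂
  step : ∀ {k G₁ G₂ G₃} → InΔ k G₁ → InΔ k G₂ → InΔ k G₃
       → (v₁ : Fin (n G₁)) (v₂ : Fin (n G₂)) (v₃ : Fin (n G₃))
       → InΔ (ℕ.suc k) (delta G₁ G₂ G₃ v₁ v₂ v₃)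
  iso  : ∀ {k G H} → InΔ k G → G ≅ H → InΔ k H

record Subgraph (G : Graph) : Set where
  field
    V : Fin (n G) → Bool
    E : Fin (n G) → Fin (n G) → Bool
    E⊆adj : ∀ i j → E i j ≡ true → adj G i j ≡ true
    E-sym : ∀ i j → E i j ≡ E j i
    E⊆V   : ∀ i j → E i j ≡ true → V i ≡ true
open Subgraph public

data Walk {m : ℕ} (E : Fin m → Fin m → Bool) : Fin m → Fin m → Set where
  []  : ∀ {a} → Walk E a a
  _∷_ : ∀ {a b c} → E a b ≡ true → Walk E b c → Walk E a c

Connected : ∀ {G} → Subgraph G → Set
Connected H = (∃ λ a → V H a ≡ true)
            × (∀ a b → V H a ≡ true → V H b ≡ true → Walk (E H) a b)

Eminus : ∀ {G} → Subgraph G → Fin (n G) → Fin (n G) → Fin (n G) → Bool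
Eminus H v i j = E H i j ∧ not (eqᵇ i v) ∧ not (eqᵇ j v)

CutVertex : ∀ {G} → Subgraph G → Fin (n G) → Set
CutVertex H v = V H v ≡ true × (∃ λ a → ∃ λ b →
  V H a ≡ true × V H b ≡ true × a ≢ v × b ≢ v × ¬ Walk (Eminus H v) a b)

_⊆ₛ_ : ∀ {G} → Subgraph G → Subgraph G → Set
H ⊆ₛ H' = (∀ i → V H i ≡ true → V H' i ≡ true)
        × (∀ i j → E H i j ≡ true → E H' i j ≡ true)

NonSeparable : ∀ {G} → Subgraph G → Set
NonSeparable H = Connected H × (∀ v → ¬ CutVertex H v)

IsBlock : ∀ {G} → Subgraph G → Set
IsBlock {G} H = NonSeparable H
  × (∀ (H' : Subgraph G) → H ⊆ₛ H' → NonSeparable H' → H' ⊆ₛ H)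

CompleteSub : ∀ {G} → Subgraph G → Set
CompleteSub H = ∀ a b → V H a ≡ true → V H b ≡ true → a ≢ b → E H a b ≡ true

BlockGraph : Graph → Set
BlockGraph G = ∀ (H : Subgraph G) → IsBlock H → CompleteSub H

Simplicial : (G : Graph) → Fin (n G) → Set
Simplicial G v = ∀ a b → adj G v a ≡ true → adj G v b ≡ true → a ≢ b
               → adj G a b ≡ true

degree : (G : Graph) → Fin (n G) → ℕ
degree G v = length (filterᵇ (adj G v) (allFin (n G)))

-- Every graph of Δₖ satisfies two invariants: every nonseparable subgraph
-- spans a clique, and every vertex is either a leaf or has two non-adjacent
-- neighbours.  The first makes every block complete (a block is maximal, so
-- it is an induced subgraph), the second excludes simplicial vertices of
-- degree at least 2.  Both invariants survive isomorphism and delta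
-- composition.  In a delta composition each summand meets the new triangle
-- in a single vertex, its hub, and every edge leaving the summand starts at
-- the hub; so the hub separates the rest of the summand from the other
-- summands, and a nonseparable subgraph containing a non-hub vertex of a
-- summand lies inside that summand.  A hub that was a leaf gains two new
-- neighbours, neither adjacent to its old neighbour.

module Submission where

open import Defs
open import Data.Nat using (ℕ; _+_; _≤_; _≥_; z≤n; s≤s)
open import Data.Nat.Properties using (≤-trans)
open import Data.Fin using (Fin; zero; suc; _≟_; splitAt; _↑ˡ_; _↑ʳ_)
open import Data.Fin.Properties using (splitAt-↑ˡ; splitAt-↑ʳ; splitAt⁻¹-↑ˡ; splitAt⁻¹-↑ʳ)
open import Data.Bool using (Bool; true; false; _∧_; _∨_; not)
open import Data.Bool.Properties using (∨-identityʳ; ∨-zeroʳ; ¬-not; T-≡)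
open import Data.Sum using (_⊎_; inj₁; inj₂; [_,_]′)
open import Data.Product using (_×_; _,_; ∃; ∃₂; proj₁; proj₂)
open import Data.List using (length; allFin)
open import Data.List.Relation.Unary.All as All using (All; []; _∷_)
open import Data.List.Relation.Unary.All.Properties using (all-filter)
open import Data.List.Relation.Unary.AllPairs using ([]; _∷_)
open import Data.List.Relation.Unary.Unique.Propositional using (Unique)
open import Data.List.Relation.Unary.Unique.Propositional.Properties using (allFin⁺; filter⁺)
open import Function using (id; const; _∘_)
open import Function.Bundles using (Equivalence)
open import Relation.Nullary using (¬_; yes; no; contradiction)
open import Relation.Binary.PropositionalEquality
  using (_≡_; _≢_; refl; sym; trans; cong; cong₂; subst; subst₂)

∧-true⁻ : ∀ {a b} → a ∧ b ≡ true → a ≡ true × b ≡ true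
∧-true⁻ {true} {true} _ = refl , refl

∧-true⁺ : ∀ {a b} → a ≡ true → b ≡ true → a ∧ b ≡ true
∧-true⁺ refl refl = refl

∧-swapˡ : ∀ a b c → a ∧ b ∧ c ≡ b ∧ a ∧ c
∧-swapˡ true  true  c = refl
∧-swapˡ true  false c = refl
∧-swapˡ false true  c = refl
∧-swapˡ false false c = refl

true≢false : true ≢ false
true≢false ()

≢⇒not-eqᵇ : ∀ {m} {i j : Fin m} → i ≢ j → not (eqᵇ i j) ≡ true
≢⇒not-eqᵇ {i = i} {j} i≢j with i ≟ j
... | yes i≡j = contradiction i≡j i≢j
... | no _    = refl

not-eqᵇ⇒≢ : ∀ {m} {i j : Fin m} → not (eqᵇ i j) ≡ true → i ≢ j
not-eqᵇ⇒≢ {i = i} e refl = true≢false (trans (sym e) (cong not (eqᵇ-refl i)))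

Walk-map : ∀ {m p} {E₁ : Fin m → Fin m → Bool} {E₂ : Fin p → Fin p → Bool}
  (h : Fin m → Fin p) → (∀ {u u'} → E₁ u u' ≡ true → E₂ (h u) (h u') ≡ true)
  → ∀ {a b} → Walk E₁ a b → Walk E₂ (h a) (h b)
Walk-map h edge []      = []
Walk-map h edge (e ∷ w) = edge e ∷ Walk-map h edge w

walk-exits-at : ∀ {m} {E : Fin m → Fin m → Bool} (S : Fin m → Bool) (c : Fin m)
  → (∀ {u u'} → E u u' ≡ true → S u ≡ true → S u' ≡ false → u ≡ c)
  → ∀ {a b} → Walk E a b → S a ≡ true → S b ≡ false → ∃ λ t → E c t ≡ true
walk-exits-at S c exit [] Sa Sb = contradiction (trans (sym Sa) Sb) true≢false
walk-exits-at {E = E} S c exit (_∷_ {b = b} e w) Sa Sb with S b in Sb′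
... | true  = walk-exits-at S c exit w Sb′ Sb
... | false = b , subst (λ t → E t b ≡ true) (exit e Sa Sb′) e

edge-endpoints : ∀ {G} (H : Subgraph G) {u u'} → E H u u' ≡ true
  → V H u ≡ true × V H u' ≡ true
edge-endpoints H {u} {u'} e = E⊆V H u u' e , E⊆V H u' u (trans (E-sym H u' u) e)

module _ {G K : Graph} (H : Subgraph G) (H' : Subgraph K)
  (φ : Fin (n K) → Fin (n G)) (ψ : Fin (n G) → Fin (n K))
  (V-φ : ∀ j → V H' j ≡ V H (φ j))
  (ψ∘φ : ∀ j → ψ (φ j) ≡ j)
  (φ∘ψ : ∀ {u} → V H u ≡ true → φ (ψ u) ≡ u)
  (E-ψ : ∀ {u u'} → E H u u' ≡ true → E H' (ψ u) (ψ u') ≡ true)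
  where

  nonSeparable-transport : NonSeparable H → NonSeparable H'
  nonSeparable-transport (((a , a∈) , walk) , noCut) =
    ((ψ a , ψa∈) , walk') , noCut'
    where
    to-H : ∀ {j} → V H' j ≡ true → V H (φ j) ≡ true
    to-H {j} = trans (sym (V-φ j))

    ψa∈ : V H' (ψ a) ≡ true
    ψa∈ = trans (V-φ (ψ a)) (subst (λ t → V H t ≡ true) (sym (φ∘ψ a∈)) a∈)

    walk' : ∀ j k → V H' j ≡ true → V H' k ≡ true → Walk (E H') j k
    walk' j k j∈ k∈ = subst₂ (Walk (E H')) (ψ∘φ j) (ψ∘φ k)
      (Walk-map ψ E-ψ (walk (φ j) (φ k) (to-H j∈) (to-H k∈)))

    φ-≢ : ∀ {j k} → j ≢ k → φ j ≢ φ k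
    φ-≢ {j} {k} j≢k p = j≢k (trans (sym (ψ∘φ j)) (trans (cong ψ p) (ψ∘φ k)))

    noCut' : ∀ v → ¬ CutVertex H' v
    noCut' v (v∈ , b , c , b∈ , c∈ , b≢v , c≢v , noWalk) =
      noCut (φ v) (to-H v∈ , φ b , φ c , to-H b∈ , to-H c∈ , φ-≢ b≢v , φ-≢ c≢v ,
        λ w → noWalk (subst₂ (Walk (Eminus H' v)) (ψ∘φ b) (ψ∘φ c) (Walk-map ψ Eminus-ψ w)))
      where
      ψ-≢ : ∀ {u} → V H u ≡ true → not (eqᵇ u (φ v)) ≡ true → not (eqᵇ (ψ u) v) ≡ true
      ψ-≢ u∈ u≢ = ≢⇒not-eqᵇ λ p → not-eqᵇ⇒≢ u≢ (trans (sym (φ∘ψ u∈)) (cong φ p))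

      Eminus-ψ : ∀ {u u'} → Eminus H (φ v) u u' ≡ true → Eminus H' v (ψ u) (ψ u') ≡ true
      Eminus-ψ e with ∧-true⁻ e
      ... | e′ , ≢s with ∧-true⁻ ≢s | edge-endpoints H e′
      ... | u≢ , u'≢ | u∈ , u'∈ = ∧-true⁺ (E-ψ e′) (∧-true⁺ (ψ-≢ u∈ u≢) (ψ-≢ u'∈ u'≢))

induced : (G : Graph) → (Fin (n G) → Bool) → Subgraph G
induced G W = record
  { V     = W
  ; E     = λ i j → W i ∧ W j ∧ adj G i j
  ; E⊆adj = λ i j e → proj₂ (∧-true⁻ {W j} (proj₂ (∧-true⁻ {W i} e)))
  ; E-sym = λ i j → trans (∧-swapˡ (W i) (W j) (adj G i j))
                          (cong (λ b → W j ∧ W i ∧ b) (adj-sym G i j))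
  ; E⊆V   = λ i j e → proj₁ (∧-true⁻ {W i} e)
  }

E⊆induced : ∀ {G} (H : Subgraph G) {i j} → E H i j ≡ true
  → E (induced G (V H)) i j ≡ true
E⊆induced H {i} {j} e with edge-endpoints H e
... | i∈ , j∈ = ∧-true⁺ i∈ (∧-true⁺ j∈ (E⊆adj H i j e))

SpansClique : ∀ {G} → Subgraph G → Set
SpansClique {G} H =
  ∀ a b → V H a ≡ true → V H b ≡ true → a ≢ b → adj G a b ≡ true

NonSeparableCliques : Graph → Set
NonSeparableCliques G = ∀ (H : Subgraph G) → NonSeparable H → SpansClique H

Leaf : (G : Graph) → Fin (n G) → Set
Leaf G v = ∃ λ a → adj G v a ≡ true × (∀ b → adj G v b ≡ true → b ≡ a)

Nonsimplicial : (G : Graph) → Fin (n G) → Set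
Nonsimplicial G v = ∃₂ λ a b →
  adj G v a ≡ true × adj G v b ≡ true × a ≢ b × adj G a b ≡ false

LeafOrNonsimplicial : Graph → Set
LeafOrNonsimplicial G = ∀ v → Leaf G v ⊎ Nonsimplicial G v

DeltaInvariant : Graph → Set
DeltaInvariant G = NonSeparableCliques G × LeafOrNonsimplicial G

nonSeparableCliques⇒blockGraph : ∀ G → NonSeparableCliques G → BlockGraph G
nonSeparableCliques⇒blockGraph G cliques H (nonSep , maximal) a b a∈ b∈ a≢b =
  proj₂ (maximal (induced G (V H)) ((λ _ → id) , (λ _ _ → E⊆induced H)) nonSepInduced) a b
    (∧-true⁺ a∈ (∧-true⁺ b∈ (cliques H nonSep a b a∈ b∈ a≢b)))
  where
  nonSepInduced : NonSeparable (induced G (V H))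
  nonSepInduced =
    nonSeparable-transport H (induced G (V H)) id id
      (λ _ → refl) (λ _ → refl) (λ _ → refl) (E⊆induced H) nonSep

Unique-constant⇒length≤1 : ∀ {A : Set} {a : A} {xs} → Unique xs → All (_≡ a) xs
  → length xs ≤ 1
Unique-constant⇒length≤1 []      []                  = z≤n
Unique-constant⇒length≤1 (_ ∷ _) (_ ∷ [])            = s≤s z≤n
Unique-constant⇒length≤1 ((x≢y ∷ _) ∷ _) (refl ∷ refl ∷ _) = contradiction refl x≢y

leaf⇒degree≤1 : ∀ G v → Leaf G v → degree G v ≤ 1
leaf⇒degree≤1 G v (a , _ , onlyA) =
  Unique-constant⇒length≤1 (filter⁺ _ (allFin⁺ (n G)))
    (All.map (λ {b} t → onlyA b (Equivalence.to T-≡ t)) (all-filter _ (allFin (n G))))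

¬simplicial-degree≥2 : ∀ G v → Leaf G v ⊎ Nonsimplicial G v
  → ¬ (Simplicial G v × degree G v ≥ 2)
¬simplicial-degree≥2 G v (inj₁ leaf) (_ , deg≥2)
  with ≤-trans deg≥2 (leaf⇒degree≤1 G v leaf)
... | s≤s ()
¬simplicial-degree≥2 G v (inj₂ (a , b , va , vb , a≢b , ab≡false)) (simplicial , _) =
  true≢false (trans (sym (simplicial a b va vb a≢b)) ab≡false)

-- `from` inverts `to` on `image` and is arbitrary elsewhere.
record Embedding (K G : Graph) : Set where
  field
    to       : Fin (n K) → Fin (n G)
    from     : Fin (n G) → Fin (n K)
    image    : Fin (n G) → Bool
    image-to : ∀ j → image (to j) ≡ true
    from∘to  : ∀ j → from (to j) ≡ j
    to∘from  : ∀ {u} → image u ≡ true → to (from u) ≡ u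
    adj-to   : ∀ j k → adj G (to j) (to k) ≡ adj K j k

module _ {K G : Graph} (e : Embedding K G) where
  open Embedding e

  to-injective : ∀ {j k} → to j ≡ to k → j ≡ k
  to-injective {j} {k} p = trans (sym (from∘to j)) (trans (cong from p) (from∘to k))

  pullback : Subgraph G → Subgraph K
  pullback H = record
    { V     = V H ∘ to
    ; E     = λ j k → E H (to j) (to k)
    ; E⊆adj = λ j k p → trans (sym (adj-to j k)) (E⊆adj H _ _ p)
    ; E-sym = λ j k → E-sym H (to j) (to k)
    ; E⊆V   = λ j k p → E⊆V H _ _ p
    }

  spansClique-to : NonSeparableCliques K → (H : Subgraph G) → NonSeparable H
    → (∀ {u} → V H u ≡ true → image u ≡ true) → SpansClique H
  spansClique-to cliques H nonSep inside a b a∈ b∈ a≢b =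
    subst₂ (λ p q → adj G p q ≡ true) (back a∈) (back b∈)
      (trans (adj-to (from a) (from b))
        (cliques (pullback H) nonSepPullback (from a) (from b)
          (in-pullback a∈) (in-pullback b∈) (λ p → a≢b (from-injective a∈ b∈ p))))
    where
    back : ∀ {u} → V H u ≡ true → to (from u) ≡ u
    back = to∘from ∘ inside

    in-pullback : ∀ {u} → V H u ≡ true → V H (to (from u)) ≡ true
    in-pullback u∈ = subst (λ t → V H t ≡ true) (sym (back u∈)) u∈

    from-injective : ∀ {u u'} → V H u ≡ true → V H u' ≡ true → from u ≡ from u' → u ≡ u'
    from-injective u∈ u'∈ p = trans (sym (back u∈)) (trans (cong to p) (back u'∈))

    E-from : ∀ {u u'} → E H u u' ≡ true → E H (to (from u)) (to (from u')) ≡ true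
    E-from p with edge-endpoints H p
    ... | u∈ , u'∈ = subst₂ (λ s t → E H s t ≡ true) (sym (back u∈)) (sym (back u'∈)) p

    nonSepPullback : NonSeparable (pullback H)
    nonSepPullback =
      nonSeparable-transport H (pullback H) to from (λ _ → refl) from∘to back E-from nonSep

  nonsimplicial-to : ∀ {j} → Nonsimplicial K j → Nonsimplicial G (to j)
  nonsimplicial-to {j} (a , b , ja , jb , a≢b , ab) =
    to a , to b , trans (adj-to j a) ja , trans (adj-to j b) jb ,
    a≢b ∘ to-injective , trans (adj-to a b) ab

  leaf-to : ∀ {j} → Leaf K j → (∀ {u} → adj G (to j) u ≡ true → image u ≡ true)
    → Leaf G (to j)
  leaf-to {j} (a , ja , onlyA) inside =
    to a , trans (adj-to j a) ja , λ b jb →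
      trans (sym (to∘from (inside jb)))
        (cong to (onlyA (from b) (trans (sym (adj-to j (from b)))
          (subst (λ t → adj G (to j) t ≡ true) (sym (to∘from (inside jb))) jb))))

≅⇒embedding : ∀ {G H} → G ≅ H → Embedding G H
≅⇒embedding φ = record
  { to       = to
  ; from     = from
  ; image    = const true
  ; image-to = λ _ → refl
  ; from∘to  = from∘to
  ; to∘from  = λ {u} _ → to∘from u
  ; adj-to   = λ j k → sym (preserves j k)
  }
  where open _≅_ φ

deltaInvariant-≅ : ∀ {G H} → G ≅ H → DeltaInvariant G → DeltaInvariant H
deltaInvariant-≅ {H = H} φ (cliques , shape) =
  (λ H' nonSep → spansClique-to e cliques H' nonSep (λ _ → refl)) ,
  λ v → subst (λ u → Leaf H u ⊎ Nonsimplicial H u) (_≅_.to∘from φ v)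
          ([ (λ leaf → inj₁ (leaf-to e leaf (λ _ → refl))) , inj₂ ∘ nonsimplicial-to e ]′
            (shape (_≅_.from φ v)))
  where e = ≅⇒embedding φ

record Component (K U : Graph) : Set where
  field
    embedding : Embedding K U
  open Embedding embedding public
  field
    closed : ∀ {u u'} → adj U u u' ≡ true → image u ≡ true → image u' ≡ true

isLeft isRight : ∀ {A B : Set} → A ⊎ B → Bool
isLeft  = [ const true  , const false ]′
isRight = [ const false , const true  ]′

inl-component : ∀ A B → Fin (n A) → Component A (A ⊕ B)
inl-component A B d = record
  { embedding = record
    { to       = _↑ˡ n B
    ; from     = [ id , const d ]′ ∘ splitAt (n A)
    ; image    = isLeft ∘ splitAt (n A)
    ; image-to = λ j → cong isLeft (splitAt-↑ˡ (n A) j (n B))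
    ; from∘to  = λ j → cong [ id , const d ]′ (splitAt-↑ˡ (n A) j (n B))
    ; to∘from  = to∘from
    ; adj-to   = λ j k → cong₂ (uadj (adj A) (adj B))
                           (splitAt-↑ˡ (n A) j (n B)) (splitAt-↑ˡ (n A) k (n B))
    }
  ; closed = closed
  }
  where
  to∘from : ∀ {u} → isLeft (splitAt (n A) u) ≡ true
    → [ id , const d ]′ (splitAt (n A) u) ↑ˡ n B ≡ u
  to∘from {u} _ with splitAt (n A) u in eq
  ... | inj₁ _ = splitAt⁻¹-↑ˡ eq

  closed : ∀ {u u'} → uadj (adj A) (adj B) (splitAt (n A) u) (splitAt (n A) u') ≡ true
    → isLeft (splitAt (n A) u) ≡ true → isLeft (splitAt (n A) u') ≡ true
  closed {u} {u'} _ _ with splitAt (n A) u | splitAt (n A) u'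
  ... | inj₁ _ | inj₁ _ = refl

inr-component : ∀ A B → Fin (n B) → Component B (A ⊕ B)
inr-component A B d = record
  { embedding = record
    { to       = n A ↑ʳ_
    ; from     = [ const d , id ]′ ∘ splitAt (n A)
    ; image    = isRight ∘ splitAt (n A)
    ; image-to = λ j → cong isRight (splitAt-↑ʳ (n A) (n B) j)
    ; from∘to  = λ j → cong [ const d , id ]′ (splitAt-↑ʳ (n A) (n B) j)
    ; to∘from  = to∘from
    ; adj-to   = λ j k → cong₂ (uadj (adj A) (adj B))
                           (splitAt-↑ʳ (n A) (n B) j) (splitAt-↑ʳ (n A) (n B) k)
    }
  ; closed = closed
  }
  where
  to∘from : ∀ {u} → isRight (splitAt (n A) u) ≡ true
    → n A ↑ʳ [ const d , id ]′ (splitAt (n A) u) ≡ u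
  to∘from {u} _ with splitAt (n A) u in eq
  ... | inj₂ _ = splitAt⁻¹-↑ʳ eq

  closed : ∀ {u u'} → uadj (adj A) (adj B) (splitAt (n A) u) (splitAt (n A) u') ≡ true
    → isRight (splitAt (n A) u) ≡ true → isRight (splitAt (n A) u') ≡ true
  closed {u} {u'} _ _ with splitAt (n A) u | splitAt (n A) u'
  ... | inj₂ _ | inj₂ _ = refl

inl-image-↑ʳ : ∀ A B d j → Component.image (inl-component A B d) (n A ↑ʳ j) ≡ false
inl-image-↑ʳ A B d j = cong isLeft (splitAt-↑ʳ (n A) (n B) j)

inr-image-↑ˡ : ∀ A B d j → Component.image (inr-component A B d) (j ↑ˡ n B) ≡ false
inr-image-↑ˡ A B d j = cong isRight (splitAt-↑ˡ (n A) j (n B))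

component-trans : ∀ {K U W} → Component K U → Component U W → Component K W
component-trans {U = U} {W = W} C₁ C₂ = record
  { embedding = record
    { to       = to₂ ∘ to₁
    ; from     = from₁ ∘ from₂
    ; image    = λ u → image₂ u ∧ image₁ (from₂ u)
    ; image-to = λ j → ∧-true⁺ (image-to₂ (to₁ j))
                         (trans (cong image₁ (from∘to₂ (to₁ j))) (image-to₁ j))
    ; from∘to  = λ j → trans (cong from₁ (from∘to₂ (to₁ j))) (from∘to₁ j)
    ; to∘from  = λ s → trans (cong to₂ (to∘from₁ (proj₂ (∧-true⁻ s))))
                             (to∘from₂ (proj₁ (∧-true⁻ s)))
    ; adj-to   = λ j k → trans (adj-to₂ (to₁ j) (to₁ k)) (adj-to₁ j k)
    }
  ; closed = closed
  }
  where
  open Component C₁ renaming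
    (to to to₁; from to from₁; image to image₁; image-to to image-to₁;
     from∘to to from∘to₁; to∘from to to∘from₁; adj-to to adj-to₁; closed to closed₁)
  open Component C₂ renaming
    (to to to₂; from to from₂; image to image₂; image-to to image-to₂;
     from∘to to from∘to₂; to∘from to to∘from₂; adj-to to adj-to₂; closed to closed₂)

  closed : ∀ {u u'} → adj W u u' ≡ true → image₂ u ∧ image₁ (from₂ u) ≡ true
    → image₂ u' ∧ image₁ (from₂ u') ≡ true
  closed {u} {u'} e s with ∧-true⁻ s
  ... | s₂ , s₁ = ∧-true⁺ s₂′ (closed₁ e′ s₁)
    where
    s₂′ = closed₂ e s₂
    e′ : adj U (from₂ u) (from₂ u') ≡ true
    e′ = trans (sym (adj-to₂ (from₂ u) (from₂ u')))
           (subst₂ (λ p q → adj W p q ≡ true) (sym (to∘from₂ s₂)) (sym (to∘from₂ s₂′)) e)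

image-trans-to : ∀ {K U W} (C₁ : Component K U) (C₂ : Component U W) u
  → Component.image (component-trans C₁ C₂) (Component.to C₂ u) ≡ Component.image C₁ u
image-trans-to C₁ C₂ u
  rewrite Component.image-to C₂ u | Component.from∘to C₂ u = refl

image-trans-out : ∀ {K U W} (C₁ : Component K U) (C₂ : Component U W) {u}
  → Component.image C₂ u ≡ false → Component.image (component-trans C₁ C₂) u ≡ false
image-trans-out C₁ C₂ out rewrite out = refl

-- The membership test used inside `addTriangle`, so that the adjacency of
-- `addTriangle U x y z` unfolds to `adj U i j ∨ (onTriangle … i ∧ onTriangle … j ∧ …)`.
onTriangle : ∀ {m} → Fin m → Fin m → Fin m → Fin m → Bool
onTriangle x y z u = eqᵇ u x ∨ eqᵇ u y ∨ eqᵇ u z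

onTriangle-x : ∀ {m} (x y z : Fin m) → onTriangle x y z x ≡ true
onTriangle-x x y z rewrite eqᵇ-refl x = refl

onTriangle-y : ∀ {m} (x y z : Fin m) → onTriangle x y z y ≡ true
onTriangle-y x y z rewrite eqᵇ-refl y = ∨-zeroʳ (eqᵇ y x)

onTriangle-z : ∀ {m} (x y z : Fin m) → onTriangle x y z z ≡ true
onTriangle-z x y z rewrite eqᵇ-refl z | ∨-zeroʳ (eqᵇ z y) = ∨-zeroʳ (eqᵇ z x)

onTriangle⁻ : ∀ {m} {x y z u : Fin m} → onTriangle x y z u ≡ true
  → u ≡ x ⊎ u ≡ y ⊎ u ≡ z
onTriangle⁻ {x = x} {y} {z} {u} on with u ≟ x | u ≟ y | u ≟ z
... | yes u≡x | _       | _       = inj₁ u≡x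
... | no _    | yes u≡y | _       = inj₂ (inj₁ u≡y)
... | no _    | no _    | yes u≡z = inj₂ (inj₂ u≡z)

module _ (U : Graph) (x y z : Fin (n U)) where
  private
    G = addTriangle U x y z
    on = onTriangle x y z

  adj-addTriangle⁻ : ∀ {i j} → adj G i j ≡ true
    → adj U i j ≡ true ⊎ (on i ≡ true × on j ≡ true × i ≢ j)
  adj-addTriangle⁻ {i} {j} = split (adj U i j) (on i) (on j)
    where
    split : ∀ a b c → a ∨ (b ∧ c ∧ not (eqᵇ i j)) ≡ true
      → a ≡ true ⊎ (b ≡ true × c ≡ true × i ≢ j)
    split true  _     _     _ = inj₁ refl
    split false true  true  e = inj₂ (refl , refl , not-eqᵇ⇒≢ e)
    split false true  false ()
    split false false _     ()

  adj-addTriangle-new : ∀ {i j} → on i ≡ true → on j ≡ true → i ≢ j → adj G i j ≡ true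
  adj-addTriangle-new {i} {j} oni onj i≢j = join (adj U i j) oni onj (≢⇒not-eqᵇ i≢j)
    where
    join : ∀ a {b c d} → b ≡ true → c ≡ true → d ≡ true → a ∨ (b ∧ c ∧ d) ≡ true
    join a refl refl refl = ∨-zeroʳ a

  adj-addTriangle-old : ∀ {i j} → (on i ≡ true → on j ≡ true → i ≡ j)
    → adj G i j ≡ adj U i j
  adj-addTriangle-old {i} {j} = keep (adj U i j) (on i) (on j)
    where
    keep : ∀ a b c → (b ≡ true → c ≡ true → i ≡ j) → a ∨ (b ∧ c ∧ not (eqᵇ i j)) ≡ a
    keep a true true same
      rewrite trans (cong (eqᵇ i) (sym (same refl refl))) (eqᵇ-refl i) = ∨-identityʳ a
    keep a true  false _ = ∨-identityʳ a
    keep a false _     _ = ∨-identityʳ a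

record Part (U : Graph) (x y z : Fin (n U)) : Set where
  field
    {K}       : Graph
    component : Component K U
  open Component component public
  field
    hub        : Fin (n U)
    hub-on     : onTriangle x y z hub ≡ true
    hub-in     : image hub ≡ true
    hub-unique : ∀ {u} → onTriangle x y z u ≡ true → image u ≡ true → u ≡ hub
    other      : Fin (n U)
    other-on   : onTriangle x y z other ≡ true
    other-out  : image other ≡ false

hub-unique-by-cases : ∀ {m} {x y z c : Fin m} (S : Fin m → Bool)
  → x ≡ c ⊎ S x ≡ false → y ≡ c ⊎ S y ≡ false → z ≡ c ⊎ S z ≡ false
  → ∀ {u} → onTriangle x y z u ≡ true → S u ≡ true → u ≡ c
hub-unique-by-cases {c = c} S hx hy hz {u} on Su =
  [ resolve hx , [ resolve hy , resolve hz ]′ ]′ (onTriangle⁻ on)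
  where
  resolve : ∀ {w} → w ≡ c ⊎ S w ≡ false → u ≡ w → u ≡ c
  resolve (inj₁ w≡c) u≡w  = trans u≡w w≡c
  resolve (inj₂ Sw)  refl = contradiction (trans (sym Su) Sw) true≢false

module _ {U : Graph} {x y z : Fin (n U)} (P : Part U x y z) where
  open Part P
  private
    G = addTriangle U x y z

  part-embedding : Embedding K G
  part-embedding = record
    { to       = to
    ; from     = from
    ; image    = image
    ; image-to = image-to
    ; from∘to  = from∘to
    ; to∘from  = to∘from
    ; adj-to   = λ j k → trans (adj-addTriangle-old U x y z λ onj onk →
                                  trans (hub-unique onj (image-to j))
                                        (sym (hub-unique onk (image-to k))))
                               (adj-to j k)
    }

  exit-at-hub : ∀ {u u'} → adj G u u' ≡ true → image u ≡ true → image u' ≡ false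
    → u ≡ hub
  exit-at-hub e in-u out-u' with adj-addTriangle⁻ U x y z e
  ... | inj₁ e-U        = contradiction (trans (sym (closed e-U in-u)) out-u') true≢false
  ... | inj₂ (on-u , _) = hub-unique on-u in-u

  nonSeparable-inside : (H : Subgraph G) → NonSeparable H
    → ∀ {a} → V H a ≡ true → image a ≡ true → a ≢ hub
    → ∀ {u} → V H u ≡ true → image u ≡ true
  nonSeparable-inside H ((_ , walk) , noCut) {a} a∈ in-a a≢hub {u} u∈
    with image u in in-u
  ... | true  = refl
  ... | false = contradiction (hub∈ , a , u , a∈ , u∈ , a≢hub , u≢hub , noWalk) (noCut hub)
    where
    u≢hub : u ≢ hub
    u≢hub refl = true≢false (trans (sym hub-in) in-u)

    hub∈ : V H hub ≡ true
    hub∈ with walk-exits-at image hub (exit-at-hub ∘ E⊆adj H _ _) (walk a u a∈ u∈) in-a in-u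
    ... | t , e = E⊆V H hub t e

    noWalk : ¬ Walk (Eminus H hub) a u
    noWalk w with walk-exits-at image hub (exit-at-hub ∘ E⊆adj H _ _ ∘ proj₁ ∘ ∧-true⁻)
                    w in-a in-u
    ... | t , e = not-eqᵇ⇒≢ {i = hub} (proj₁ (∧-true⁻ (proj₂ (∧-true⁻ {E H hub t} e)))) refl

  spansClique-part : NonSeparableCliques K → (H : Subgraph G) → NonSeparable H
    → ∀ {a b} → V H a ≡ true → V H b ≡ true → image a ≡ true → a ≢ hub → a ≢ b
    → adj G a b ≡ true
  spansClique-part cliques H nonSep {a} {b} a∈ b∈ in-a a≢hub =
    spansClique-to part-embedding cliques H nonSep
      (nonSeparable-inside H nonSep a∈ in-a a≢hub) a b a∈ b∈

  leafOrNonsimplicial-part : LeafOrNonsimplicial K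
    → ∀ {w} → image w ≡ true → Leaf G w ⊎ Nonsimplicial G w
  leafOrNonsimplicial-part shape in-w =
    subst (λ t → Leaf G t ⊎ Nonsimplicial G t) (to∘from in-w) (at (from _))
    where
    hub-nonsimplicial : ∀ {j} → Leaf K j → to j ≡ hub → Nonsimplicial G (to j)
    hub-nonsimplicial {j} (a , ja , _) j≡hub =
      to a , other , trans (Embedding.adj-to part-embedding j a) ja ,
      adj-addTriangle-new U x y z (subst (λ t → onTriangle x y z t ≡ true) (sym j≡hub) hub-on)
        other-on (outside (image-to j)) ,
      outside (image-to a) ,
      ¬-not (λ e → true≢false (trans (sym (self-adjacent e)) (adj-irrefl K j)))
      where
      self-adjacent : adj G (to a) other ≡ true → adj K j j ≡ true
      self-adjacent e = subst (λ t → adj K j t ≡ true)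
        (to-injective part-embedding (trans (exit-at-hub e (image-to a) other-out) (sym j≡hub)))
        ja

      outside : ∀ {u} → image u ≡ true → u ≢ other
      outside in-u refl = true≢false (trans (sym in-u) other-out)

    at : ∀ j → Leaf G (to j) ⊎ Nonsimplicial G (to j)
    at j with shape j
    ... | inj₂ nonsimplicial = inj₂ (nonsimplicial-to part-embedding nonsimplicial)
    ... | inj₁ leaf with to j ≟ hub
    ...   | yes j≡hub = inj₂ (hub-nonsimplicial leaf j≡hub)
    ...   | no j≢hub  = inj₁ (leaf-to part-embedding leaf inside)
      where
      inside : ∀ {u} → adj G (to j) u ≡ true → image u ≡ true
      inside {u} e with image u in in-u
      ... | true  = refl
      ... | false = contradiction (exit-at-hub e (image-to j) in-u) j≢hub

deltaInvariant-addTriangle : ∀ U (x y z : Fin (n U))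
  → (∀ u → ∃ λ (P : Part U x y z) → DeltaInvariant (Part.K P) × Part.image P u ≡ true)
  → DeltaInvariant (addTriangle U x y z)
deltaInvariant-addTriangle U x y z cover = cliques , shape
  where
  G = addTriangle U x y z

  cliques : NonSeparableCliques G
  cliques H nonSep a b a∈ b∈ a≢b with cover a | cover b
  ... | P , (cliquesP , _) , in-a | Q , (cliquesQ , _) , in-b
    with a ≟ Part.hub P | b ≟ Part.hub Q
  ... | no a≢hub | _ = spansClique-part P cliquesP H nonSep a∈ b∈ in-a a≢hub a≢b
  ... | yes _ | no b≢hub = trans (adj-sym G a b)
    (spansClique-part Q cliquesQ H nonSep b∈ a∈ in-b b≢hub (a≢b ∘ sym))
  ... | yes refl | yes refl =
    adj-addTriangle-new U x y z (Part.hub-on P) (Part.hub-on Q) a≢b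

  shape : LeafOrNonsimplicial G
  shape w with cover w
  ... | P , (_ , shapeP) , in-w = leafOrNonsimplicial-part P shapeP in-w

module _ {G₁ G₂ G₃ : Graph} (v₁ : Fin (n G₁)) (v₂ : Fin (n G₂)) (v₃ : Fin (n G₃)) where
  private
    U = G₁ ⊕ (G₂ ⊕ G₃)
    x y z : Fin (n U)
    x = v₁ ↑ˡ (n G₂ + n G₃)
    y = n G₁ ↑ʳ (v₂ ↑ˡ n G₃)
    z = n G₁ ↑ʳ (n G₂ ↑ʳ v₃)
    C₁ = inl-component G₁ (G₂ ⊕ G₃) v₁
    C₂₃ = inr-component G₁ (G₂ ⊕ G₃) (v₂ ↑ˡ n G₃)
    C₂ = component-trans (inl-component G₂ G₃ v₂) C₂₃
    C₃ = component-trans (inr-component G₂ G₃ v₃) C₂₃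

    ↑ʳ∉C₁ : ∀ j → Component.image C₁ (n G₁ ↑ʳ j) ≡ false
    ↑ʳ∉C₁ = inl-image-↑ʳ G₁ (G₂ ⊕ G₃) v₁

    x∉C₂₃ : Component.image C₂₃ x ≡ false
    x∉C₂₃ = inr-image-↑ˡ G₁ (G₂ ⊕ G₃) (v₂ ↑ˡ n G₃) v₁

    via-C₂₃ : ∀ {K u r} (C : Component K (G₂ ⊕ G₃)) → splitAt (n G₁) u ≡ inj₂ r
      → Component.image C r ≡ true → Component.image (component-trans C C₂₃) u ≡ true
    via-C₂₃ C eq in-r = subst (λ t → Component.image (component-trans C C₂₃) t ≡ true)
      (splitAt⁻¹-↑ʳ eq) (trans (image-trans-to C C₂₃ _) in-r)

    part₁ : Part U x y z
    part₁ = record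
      { component  = C₁
      ; hub        = x
      ; hub-on     = onTriangle-x x y z
      ; hub-in     = Component.image-to C₁ v₁
      ; hub-unique = hub-unique-by-cases (Component.image C₁)
                       (inj₁ refl) (inj₂ (↑ʳ∉C₁ _)) (inj₂ (↑ʳ∉C₁ _))
      ; other      = y
      ; other-on   = onTriangle-y x y z
      ; other-out  = ↑ʳ∉C₁ _
      }

    part₂ : Part U x y z
    part₂ = record
      { component  = C₂
      ; hub        = y
      ; hub-on     = onTriangle-y x y z
      ; hub-in     = Component.image-to C₂ v₂
      ; hub-unique = hub-unique-by-cases (Component.image C₂)
                       (inj₂ (image-trans-out (inl-component G₂ G₃ v₂) C₂₃ x∉C₂₃))
                       (inj₁ refl)
                       (inj₂ (trans (image-trans-to (inl-component G₂ G₃ v₂) C₂₃ _)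
                                    (inl-image-↑ʳ G₂ G₃ v₂ v₃)))
      ; other      = x
      ; other-on   = onTriangle-x x y z
      ; other-out  = image-trans-out (inl-component G₂ G₃ v₂) C₂₃ x∉C₂₃
      }

    part₃ : Part U x y z
    part₃ = record
      { component  = C₃
      ; hub        = z
      ; hub-on     = onTriangle-z x y z
      ; hub-in     = Component.image-to C₃ v₃
      ; hub-unique = hub-unique-by-cases (Component.image C₃)
                       (inj₂ (image-trans-out (inr-component G₂ G₃ v₃) C₂₃ x∉C₂₃))
                       (inj₂ (trans (image-trans-to (inr-component G₂ G₃ v₃) C₂₃ _)
                                    (inr-image-↑ˡ G₂ G₃ v₃ v₂)))
                       (inj₁ refl)
      ; other      = x
      ; other-on   = onTriangle-x x y z
      ; other-out  = image-trans-out (inr-component G₂ G₃ v₃) C₂₃ x∉C₂₃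
      }

  deltaInvariant-delta : DeltaInvariant G₁ → DeltaInvariant G₂ → DeltaInvariant G₃
    → DeltaInvariant (delta G₁ G₂ G₃ v₁ v₂ v₃)
  deltaInvariant-delta I₁ I₂ I₃ = deltaInvariant-addTriangle U x y z cover
    where
    cover : ∀ u → ∃ λ (P : Part U x y z) → DeltaInvariant (Part.K P) × Part.image P u ≡ true
    cover u with splitAt (n G₁) u in eq₁
    ... | inj₁ _ = part₁ , I₁ , cong isLeft eq₁
    ... | inj₂ r with splitAt (n G₂) r in eq₂
    ...   | inj₁ _ = part₂ , I₂ , via-C₂₃ (inl-component G₂ G₃ v₂) eq₁ (cong isLeft eq₂)
    ...   | inj₂ _ = part₃ , I₃ , via-C₂₃ (inr-component G₂ G₃ v₃) eq₁ (cong isRight eq₂)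

deltaInvariant-K₂ : DeltaInvariant K₂
deltaInvariant-K₂ = (λ _ _ _ _ _ _ → ≢⇒not-eqᵇ) , leaf
  where
  leaf : LeafOrNonsimplicial K₂
  leaf zero       = inj₁ (suc zero , refl , λ { zero () ; (suc zero) _ → refl })
  leaf (suc zero) = inj₁ (zero , refl , λ { zero _ → refl ; (suc zero) () })

deltaInvariant : ∀ {k G} → InΔ k G → DeltaInvariant G
deltaInvariant base                      = deltaInvariant-K₂
deltaInvariant (step h₁ h₂ h₃ v₁ v₂ v₃) =
  deltaInvariant-delta v₁ v₂ v₃ (deltaInvariant h₁) (deltaInvariant h₂) (deltaInvariant h₃)
deltaInvariant (iso h φ)                 = deltaInvariant-≅ φ (deltaInvariant h)

lemma4p1 : (k : ℕ) (G : Graph) → InΔ k G →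
    BlockGraph G × (∀ (v : Fin (n G)) → ¬ (Simplicial G v × degree G v ≥ 2))
lemma4p1 k G h =
  let (cliques , shape) = deltaInvariant h
  in nonSeparableCliques⇒blockGraph G cliques , λ v → ¬simplicial-degree≥2 G v (shape v)
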